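{- Let $m,n$ be integers with $1\le m\le n$, and let $\pi\in\mathcal{S}_n$ be chosen uniformly at random. Then \[ \frac{1}{2m} \le \mathbb{P}(\pi \text{ has no cycle of length } < m) \le \frac{1}{m}. \]
   Context: $\mathcal{S}_n$ is the symmetric group on $\{1,\dots,n\}$; cycle lengths refer to the cycle decomposition of $\pi$ (fixed points count as cycles of length $1$). -}

module Defs where

open import Data.Nat using (ℕ; zero; suc; _≤_; _<?_; _≤?_)
open import Data.Fin using (Fin; toℕ)
open import Data.Fin.Properties using (all?) renaming (_≟_ to _≟ᶠ_)
open import Data.Vec using (Vec; []; _∷_; lookup)
open import Data.List using (List; []; _∷_; map; concatMap; filter; length)
open import Data.List using () renaming ([_] to L[_])
open import Data.Fin using () renaming (zero to fz)
open import Data.List.Base using ()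
open import Relation.Binary.PropositionalEquality using (_≡_)
open import Relation.Nullary using (¬_; Dec)
open import Relation.Nullary.Decidable using (_→-dec_; ¬?)

allFin : (n : ℕ) → List (Fin n)
allFin n = Data.List.allFin n

allVecs : (n k : ℕ) → List (Vec (Fin n) k)
allVecs n zero    = L[ [] ]
allVecs n (suc k) = concatMap (λ x → map (x ∷_) (allVecs n k)) (allFin n)

-- A map Fin n → Fin n (given as a vector of values) is a permutation
-- iff it is injective (Fin n is finite).
IsPerm : {n : ℕ} → Vec (Fin n) n → Set
IsPerm {n} v = (i j : Fin n) → lookup v i ≡ lookup v j → i ≡ j

isPerm? : {n : ℕ} (v : Vec (Fin n) n) → Dec (IsPerm v)
isPerm? v = all? (λ i → all? (λ j → (lookup v i ≟ᶠ lookup v j) →-dec (i ≟ᶠ j)))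

Sym : (n : ℕ) → List (Vec (Fin n) n)
Sym n = filter isPerm? (allVecs n n)

iter : {n : ℕ} → Vec (Fin n) n → ℕ → Fin n → Fin n
iter v zero    i = i
iter v (suc k) i = lookup v (iter v k i)

NoShortCycle : {n : ℕ} → ℕ → Vec (Fin n) n → Set
NoShortCycle {n} m v = (i : Fin n) (k : Fin m) → 1 ≤ toℕ k → ¬ (iter v (toℕ k) i ≡ i)

noShortCycle? : {n : ℕ} (m : ℕ) (v : Vec (Fin n) n) → Dec (NoShortCycle m v)
noShortCycle? m v = all? (λ i → all? (λ k → (1 ≤? toℕ k) →-dec ¬? (iter v (toℕ k) i ≟ᶠ i)))

countNoShort : (m n : ℕ) → ℕ
countNoShort m n = length (filter (noShortCycle? m) (Sym n))

module Submission where

-- Make 0 a distinguished root and let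
-- B(n, k) count the permutations of {0, …, n} whose cycles shorter than m all
-- pass through the root and whose root cycle has length ≥ k (so a(n+1) = B(n, m)).
-- Splitting on π(0): if π(0) = 0 then π fixes the root and is a permutation of
-- the other n points without short cycles; otherwise π arises uniquely from a
-- permutation of one point fewer by inserting the new point π(0) right after the
-- root, which lengthens the root cycle by one.  This yields
--   B(n+1, 1) = a(n+1) + (n+1)·B(n, 1),   B(n+1, k+2) = (n+1)·B(n, k+1).  Finally the recurrences alone (as a record of
-- hypotheses on arbitrary sequences) give the bounds by strong induction on an
-- invariant for C(j) = B(j, 1), and with m = 1 give |S_n| = n!.

open import Defs
open import Data.Nat using (ℕ; zero; suc; _+_; _*_; _∸_; _!; _≤_; _<_; s≤s; z≤n; _≤?_; _<?_)
open import Data.Nat.Properties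
  using ( ≤-refl; ≤-pred; <⇒≤; <⇒≱; ≮⇒≥; <-trans; <-≤-trans; n<1+n; m<n⇒m<1+n; m<1+n⇒m<n∨m≡n
        ; m≤n+m; m∸n≤m; m∸n+n≡m; +-comm; +-suc; +-identityʳ; *-comm; *-assoc; *-zeroʳ; *-distribˡ-+
        ; +-mono-≤; +-monoˡ-≤; *-monoˡ-≤; *-monoʳ-≤; *-cancelʳ-≤; _!≢0; allUpTo?; anyUpTo?
        ; module ≤-Reasoning )
open import Data.Nat.Induction using (<-rec)
open import Data.Nat.Tactic.RingSolver using (solve-∀)
open import Data.Fin using (Fin; toℕ; fromℕ<; punchIn; punchOut) renaming (zero to fz; suc to fs)
open import Data.Fin.Properties
  using ( toℕ<n; toℕ-fromℕ<; all?; suc-injective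
        ; punchIn-injective; punchInᵢ≢i; punchIn-punchOut; punchOut-punchIn; punchOut-cong )
  renaming (_≟_ to _≟ᶠ_)
open import Data.Vec using (Vec; []; _∷_; lookup; tabulate)
import Data.Vec as V
open import Data.Vec.Properties using (∷-injective; lookup∘tabulate; tabulate∘lookup; tabulate-cong; lookup-map)
open import Data.List using (List; []; _∷_; map; filter; length; concatMap; cartesianProductWith; _++_)
open import Data.List.Properties using (length-map; length-++; length-tabulate; filter-all; filter-none; filter-≐)
open import Data.List.Relation.Unary.Unique.Propositional using (Unique; _∷_; [])
open import Data.List.Relation.Unary.Unique.Propositional.Properties
  using (cartesianProductWith⁺; allFin⁺; filter⁺; map⁺)
open import Data.List.Relation.Unary.All using ([])
import Data.List.Relation.Unary.All as All
open import Data.List.Relation.Unary.Any using (here)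
open import Data.List.Membership.Propositional using (_∈_)
open import Data.List.Membership.Propositional.Properties
  using (∈-filter⁺; ∈-filter⁻; ∈-cartesianProductWith⁺; ∈-cartesianProductWith⁻; ∈-allFin; ∈-map⁺; ∈-map⁻)
open import Data.List.Membership.Propositional.Properties.WithK using (unique∧set⇒bag)
open import Data.List.Relation.Binary.BagAndSetEquality using (∼bag⇒↭)
open import Data.List.Relation.Binary.Permutation.Propositional.Properties using (↭-length)
open import Data.Product using (_×_; _,_; proj₁; proj₂; ∃-syntax)
open import Data.Sum using (_⊎_; inj₁; inj₂)
open import Function.Bundles using (_⇔_; mk⇔)
open import Relation.Binary.PropositionalEquality
open import Function using (_∘_)
open import Relation.Nullary using (Dec; yes; no)
open import Data.Empty using (⊥; ⊥-elim)
open import Relation.Nullary.Decidable using (_→-dec_; ¬?; _×-dec_; map′)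
open import Relation.Unary using (Decidable)

length-cartesianProductWith : {A B C : Set} (f : A → B → C) (xs : List A) (ys : List B) →
  length (cartesianProductWith f xs ys) ≡ length xs * length ys
length-cartesianProductWith f []       ys = refl
length-cartesianProductWith f (x ∷ xs) ys = trans (length-++ (map (f x) ys))
  (cong₂ _+_ (length-map (f x) ys) (length-cartesianProductWith f xs ys))

length-filter-split : {A : Set} {Q : A → Set} (Q? : Decidable Q) (xs : List A) →
  length xs ≡ length (filter Q? xs) + length (filter (λ x → ¬? (Q? x)) xs)
length-filter-split Q? []       = refl
length-filter-split Q? (x ∷ xs) with Q? x
... | yes _ = cong suc (length-filter-split Q? xs)
... | no  _ = trans (cong suc (length-filter-split Q? xs)) (sym (+-suc _ _))

-- Two duplicate-free lists with the same members have the same length;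
-- this is how every count below is identified with another one.
length-unique-≈ : {A : Set} {xs ys : List A} → Unique xs → Unique ys →
  (∀ {x} → x ∈ xs ⇔ x ∈ ys) → length xs ≡ length ys
length-unique-≈ xs! ys! xs≈ys = ↭-length (∼bag⇒↭ (unique∧set⇒bag xs! ys! xs≈ys))

lookup-ext : ∀ {A : Set} {n} (u v : Vec A n) → (∀ i → lookup u i ≡ lookup v i) → u ≡ v
lookup-ext u v u≗v = trans (sym (tabulate∘lookup u)) (trans (tabulate-cong u≗v) (tabulate∘lookup v))

allVecs-suc : ∀ n k → allVecs n (suc k) ≡ cartesianProductWith _∷_ (allFin n) (allVecs n k)
allVecs-suc n k = concatMap≡product (allFin n)
  where
    concatMap≡product : (xs : List (Fin n)) →
      concatMap (λ x → map (x ∷_) (allVecs n k)) xs ≡ cartesianProductWith _∷_ xs (allVecs n k)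
    concatMap≡product []       = refl
    concatMap≡product (x ∷ xs) = cong (map (x ∷_) (allVecs n k) ++_) (concatMap≡product xs)

allVecs-unique : ∀ n k → Unique (allVecs n k)
allVecs-unique n zero    = [] ∷ []
allVecs-unique n (suc k) rewrite allVecs-suc n k =
  cartesianProductWith⁺ _∷_ ∷-injective (allFin⁺ n) (allVecs-unique n k)

∈-allVecs : ∀ n k (v : Vec (Fin n) k) → v ∈ allVecs n k
∈-allVecs n zero    []      = here refl
∈-allVecs n (suc k) (x ∷ v) rewrite allVecs-suc n k =
  ∈-cartesianProductWith⁺ _∷_ (∈-allFin x) (∈-allVecs n k v)

Sym-unique : ∀ n → Unique (Sym n)
Sym-unique n = filter⁺ isPerm? (allVecs-unique n n)

∈-Sym⁺ : ∀ {n} {v : Vec (Fin n) n} → IsPerm v → v ∈ Sym n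
∈-Sym⁺ {n} {v} = ∈-filter⁺ isPerm? (∈-allVecs n n v)

∈-Sym⁻ : ∀ {n} {v : Vec (Fin n) n} → v ∈ Sym n → IsPerm v
∈-Sym⁻ {n} v∈ = proj₂ (∈-filter⁻ isPerm? {xs = allVecs n n} v∈)

iter-lookup : ∀ {n} (π : Vec (Fin n) n) t x → iter π t (lookup π x) ≡ iter π (suc t) x
iter-lookup π zero    x = refl
iter-lookup π (suc t) x = cong (lookup π) (iter-lookup π t x)

iter-+ : ∀ {n} (π : Vec (Fin n) n) a b x → iter π a (iter π b x) ≡ iter π (a + b) x
iter-+ π zero    b x = refl
iter-+ π (suc a) b x = cong (lookup π) (iter-+ π a b x)

iter-comm : ∀ {n} (π : Vec (Fin n) n) a b x → iter π a (iter π b x) ≡ iter π b (iter π a x)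
iter-comm π a b x = trans (iter-+ π a b x)
  (trans (cong (λ c → iter π c x) (+-comm a b)) (sym (iter-+ π b a x)))

NoShortCycleℕ : ∀ {n} → ℕ → Vec (Fin n) n → Set
NoShortCycleℕ m π = ∀ i t → t < m → 1 ≤ t → iter π t i ≢ i

noShortCycle⇒ℕ : ∀ {n} m (π : Vec (Fin n) n) → NoShortCycle m π → NoShortCycleℕ m π
noShortCycle⇒ℕ m π ns i t t<m 1≤t =
  subst (λ u → 1 ≤ u → iter π u i ≢ i) (toℕ-fromℕ< t<m) (ns i (fromℕ< t<m)) 1≤t

ℕ⇒noShortCycle : ∀ {n} m (π : Vec (Fin n) n) → NoShortCycleℕ m π → NoShortCycle m π
ℕ⇒noShortCycle m π ns i k = ns i (toℕ k) (toℕ<n k)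

-- For a permutation of Fin (suc n) the point 0 is the root.  The counting
-- argument tracks two conditions: the cycle through the root is long ...
RootCycle≥ : ∀ {n} → ℕ → Vec (Fin (suc n)) (suc n) → Set
RootCycle≥ k π = ∀ t → t < k → 1 ≤ t → iter π t fz ≢ fz

-- ... and every cycle shorter than m passes through the root (a point that
-- returns after t < m steps meets 0 before).
ShortCyclesAtRoot : ∀ {n} → ℕ → Vec (Fin (suc n)) (suc n) → Set
ShortCyclesAtRoot m π =
  ∀ x t → t < m → 1 ≤ t → iter π t x ≡ x → ∃[ s ] s < t × iter π s x ≡ fz

Rooted : ∀ {n} → ℕ → ℕ → Vec (Fin (suc n)) (suc n) → Set
Rooted m k π = RootCycle≥ k π × ShortCyclesAtRoot m π

∀<? : {P : ℕ → Set} → Decidable P → ∀ k → Dec (∀ t → t < k → P t)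
∀<? P? k = map′ (λ all t → all {t}) (λ all {t} → all t) (allUpTo? P? k)

rooted? : ∀ {n} m k (π : Vec (Fin (suc n)) (suc n)) → Dec (Rooted m k π)
rooted? m k π = rootCycle? ×-dec short?
  where
    rootCycle? = ∀<? (λ t → (1 ≤? t) →-dec ¬? (iter π t fz ≟ᶠ fz)) k
    short? = all? λ x → ∀<? (λ t → (1 ≤? t) →-dec ((iter π t x ≟ᶠ x) →-dec
                                   anyUpTo? (λ s → iter π s x ≟ᶠ fz) t)) m

-- With k = m, 'Rooted' is exactly the absence of cycles shorter than m: a
-- short cycle through the root is excluded by the first condition.
noShortCycle⇒rooted : ∀ {n} m (π : Vec (Fin (suc n)) (suc n)) → NoShortCycleℕ m π → Rooted m m π
noShortCycle⇒rooted m π ns =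
  (λ t t<m 1≤t → ns fz t t<m 1≤t) , (λ x t t<m 1≤t eq → ⊥-elim (ns x t t<m 1≤t eq))

rooted⇒noShortCycle : ∀ {n} m (π : Vec (Fin (suc n)) (suc n)) → Rooted m m π → NoShortCycleℕ m π
rooted⇒noShortCycle m π (rootCycle , short) x t t<m 1≤t eq
  with s , _ , πˢx≡0 ← short x t t<m 1≤t eq = rootCycle t t<m 1≤t (begin
    iter π t fz            ≡⟨ cong (iter π t) (sym πˢx≡0) ⟩
    iter π t (iter π s x)  ≡⟨ iter-comm π t s x ⟩
    iter π s (iter π t x)  ≡⟨ cong (iter π s) eq ⟩
    iter π s x             ≡⟨ πˢx≡0 ⟩
    fz                     ∎)
  where open ≡-Reasoning

-- Permutations fixing the root

fixRoot : ∀ {n} → Vec (Fin n) n → Vec (Fin (suc n)) (suc n)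
fixRoot σ = fz ∷ V.map fs σ

fixRoot-suc : ∀ {n} (σ : Vec (Fin n) n) i → lookup (fixRoot σ) (fs i) ≡ fs (lookup σ i)
fixRoot-suc σ i = lookup-map i fs σ

iter-fixRoot : ∀ {n} (σ : Vec (Fin n) n) t i → iter (fixRoot σ) t (fs i) ≡ fs (iter σ t i)
iter-fixRoot σ zero    i = refl
iter-fixRoot σ (suc t) i = trans (cong (lookup (fixRoot σ)) (iter-fixRoot σ t i)) (fixRoot-suc σ _)

fixRoot-injective : ∀ {n} {σ₁ σ₂ : Vec (Fin n) n} → fixRoot σ₁ ≡ fixRoot σ₂ → σ₁ ≡ σ₂
fixRoot-injective {σ₁ = σ₁} {σ₂} eq = lookup-ext σ₁ σ₂ λ i → suc-injective
  (trans (sym (fixRoot-suc σ₁ i)) (trans (cong (λ v → lookup v (fs i)) eq) (fixRoot-suc σ₂ i)))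

fixRoot-perm⁺ : ∀ {n} (σ : Vec (Fin n) n) → IsPerm σ → IsPerm (fixRoot σ)
fixRoot-perm⁺ σ σ-inj fz     fz     eq = refl
fixRoot-perm⁺ σ σ-inj fz     (fs j) eq with () ← trans eq (fixRoot-suc σ j)
fixRoot-perm⁺ σ σ-inj (fs i) fz     eq with () ← trans (sym (fixRoot-suc σ i)) eq
fixRoot-perm⁺ σ σ-inj (fs i) (fs j) eq =
  cong fs (σ-inj i j (suc-injective (trans (sym (fixRoot-suc σ i)) (trans eq (fixRoot-suc σ j)))))

fixRoot-perm⁻ : ∀ {n} (σ : Vec (Fin n) n) → IsPerm (fixRoot σ) → IsPerm σ
fixRoot-perm⁻ σ π-inj i j eq =
  suc-injective (π-inj (fs i) (fs j) (trans (fixRoot-suc σ i) (trans (cong fs eq) (sym (fixRoot-suc σ j)))))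

-- The only short cycle of 'fixRoot σ' through the root is the fixed point 0
-- itself, so its short cycles all lie at the root iff σ has none.
fixRoot-short⁺ : ∀ {n} m (σ : Vec (Fin n) n) → NoShortCycleℕ m σ → ShortCyclesAtRoot m (fixRoot σ)
fixRoot-short⁺ m σ ns fz     t t<m 1≤t eq = 0 , 1≤t , refl
fixRoot-short⁺ m σ ns (fs i) t t<m 1≤t eq =
  ⊥-elim (ns i t t<m 1≤t (suc-injective (trans (sym (iter-fixRoot σ t i)) eq)))

fixRoot-short⁻ : ∀ {n} m (σ : Vec (Fin n) n) → ShortCyclesAtRoot m (fixRoot σ) → NoShortCycleℕ m σ
fixRoot-short⁻ m σ short i t t<m 1≤t eq
  with s , _ , πˢi≡0 ← short (fs i) t t<m 1≤t (trans (iter-fixRoot σ t i) (cong fs eq))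
  with () ← trans (sym (iter-fixRoot σ s i)) πˢi≡0

module _ {n} (π : Vec (Fin (suc n)) (suc n)) (π-inj : IsPerm π) (π0≡0 : lookup π fz ≡ fz) where

  private
    0≢π[suc] : ∀ i → fz ≢ lookup π (fs i)
    0≢π[suc] i e with () ← π-inj (fs i) fz (trans (sym e) (sym π0≡0))

  unfixRoot : Vec (Fin n) n
  unfixRoot = tabulate λ i → punchOut (0≢π[suc] i)

  fixRoot-unfixRoot : fixRoot unfixRoot ≡ π
  fixRoot-unfixRoot = lookup-ext _ _ entries
    where
      entries : ∀ x → lookup (fixRoot unfixRoot) x ≡ lookup π x
      entries fz     = sym π0≡0
      entries (fs i) = trans (fixRoot-suc unfixRoot i)
        (trans (cong fs (lookup∘tabulate _ i)) (punchIn-punchOut (0≢π[suc] i)))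

-- Inserting a new point right after the root

-- The old points Fin (suc n) are relabelled into Fin (suc (suc n)) by skipping
-- the new point 'fs e''; the root 0 keeps its label.
skip : ∀ {n} → Fin (suc n) → Fin (suc n) → Fin (suc (suc n))
skip e' = punchIn (fs e')

skip-root : ∀ {n} (e' : Fin (suc n)) i → skip e' i ≡ fz → i ≡ fz
skip-root e' fz     _ = refl
skip-root e' (fs i) ()

skip≢new : ∀ {n} (e' : Fin (suc n)) i → skip e' i ≢ fs e'
skip≢new e' = punchInᵢ≢i (fs e')

skip-injective : ∀ {n} (e' : Fin (suc n)) {i j} → skip e' i ≡ skip e' j → i ≡ j
skip-injective e' = punchIn-injective (fs e') _ _

skip-view : ∀ {n} (e' : Fin (suc n)) x → x ≡ fs e' ⊎ ∃[ i ] x ≡ skip e' i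
skip-view e' x with fs e' ≟ᶠ x
... | yes e≡x = inj₁ (sym e≡x)
... | no  e≢x = inj₂ (punchOut e≢x , sym (punchIn-punchOut e≢x))

-- π arises from σ by inserting the new point e = fs e' into the cycle of the
-- root, directly after it: 0 ↦ e ↦ σ(0), and otherwise π acts like σ.
record Insertion {n} (e' : Fin (suc n)) (σ : Vec (Fin (suc n)) (suc n))
                 (π : Vec (Fin (suc (suc n))) (suc (suc n))) : Set where
  field
    root↦new : lookup π fz ≡ fs e'
    new↦next : lookup π (fs e') ≡ skip e' (lookup σ fz)
    old↦old  : ∀ i → i ≢ fz → lookup π (skip e' i) ≡ skip e' (lookup σ i)

-- An insertion preserves everything the count tracks, lengthening only the root's cycle by one.
module InsertionProperties {n} {e' : Fin (suc n)} {σ π} (ins : Insertion e' σ π) where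

  open Insertion ins
  open ≡-Reasoning

  -- Away from the root, π-orbits of old points follow σ-orbits (phrased once
  -- with the hypothesis on σ and once on π).
  iter-skipσ : ∀ t i → (∀ s → s < t → iter σ s i ≢ fz) → iter π t (skip e' i) ≡ skip e' (iter σ t i)
  iter-skipσ zero    i avoids = refl
  iter-skipσ (suc t) i avoids = begin
    lookup π (iter π t (skip e' i))   ≡⟨ cong (lookup π) (iter-skipσ t i (λ s s<t → avoids s (m<n⇒m<1+n s<t))) ⟩
    lookup π (skip e' (iter σ t i))   ≡⟨ old↦old _ (avoids t ≤-refl) ⟩
    skip e' (iter σ (suc t) i)        ∎

  iter-skipπ : ∀ t i → (∀ s → s < t → iter π s (skip e' i) ≢ fz) → iter π t (skip e' i) ≡ skip e' (iter σ t i)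
  iter-skipπ zero    i avoids = refl
  iter-skipπ (suc t) i avoids = begin
    lookup π (iter π t (skip e' i))   ≡⟨ cong (lookup π) ih ⟩
    lookup π (skip e' (iter σ t i))   ≡⟨ old↦old _ (λ σᵗi≡0 → avoids t ≤-refl (trans ih (cong (skip e') σᵗi≡0))) ⟩
    skip e' (iter σ (suc t) i)        ∎
    where ih = iter-skipπ t i (λ s s<t → avoids s (m<n⇒m<1+n s<t))

  iter-new : ∀ t → iter π (suc t) (fs e') ≡ iter π t (skip e' (lookup σ fz))
  iter-new t = trans (sym (iter-lookup π t (fs e'))) (cong (iter π t) new↦next)

  iter-root : ∀ t → iter π (suc t) fz ≡ iter π t (fs e')
  iter-root t = trans (sym (iter-lookup π t fz)) (cong (iter π t) root↦new)

  iter-root-skip : ∀ t → (∀ s → s < t → iter σ (suc s) fz ≢ fz) →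
    iter π (suc (suc t)) fz ≡ skip e' (iter σ (suc t) fz)
  iter-root-skip t avoids = begin
    iter π (suc (suc t)) fz              ≡⟨ iter-root (suc t) ⟩
    iter π (suc t) (fs e')               ≡⟨ iter-new t ⟩
    iter π t (skip e' (lookup σ fz))     ≡⟨ iter-skipσ t _ (λ s s<t e → avoids s s<t (trans (sym (iter-lookup σ s fz)) e)) ⟩
    skip e' (iter σ t (lookup σ fz))     ≡⟨ cong (skip e') (iter-lookup σ t fz) ⟩
    skip e' (iter σ (suc t) fz)          ∎

  rootCycle⁺ : ∀ k → RootCycle≥ k σ → RootCycle≥ (suc k) π
  rootCycle⁺ k long (suc zero) _ _ π0≡0 = skip≢new e' fz (sym (trans (sym root↦new) π0≡0))
  rootCycle⁺ k long (suc (suc t)) (s≤s t+1<k) _ eq = long (suc t) t+1<k (s≤s z≤n)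
    (skip-root e' _ (trans (sym (iter-root-skip t avoids)) eq))
    where
      avoids : ∀ s → s < t → iter σ (suc s) fz ≢ fz
      avoids s s<t = long (suc s) (<-trans (s≤s s<t) t+1<k) (s≤s z≤n)

  rootCycle⁻ : ∀ k → RootCycle≥ (suc k) π → RootCycle≥ k σ
  rootCycle⁻ k long zero    _   ()
  rootCycle⁻ k long (suc t) t<k _ = avoids (suc t) t<k t ≤-refl
    where
      avoids : ∀ t → t < k → ∀ s → s < t → iter σ (suc s) fz ≢ fz
      avoids zero    _     s ()
      avoids (suc t) t+1<k s s<t+1 with m<1+n⇒m<n∨m≡n s<t+1
      ... | inj₁ s<t  = avoids t (<-trans (n<1+n t) t+1<k) s s<t
      ... | inj₂ refl = λ eq → long (suc (suc s)) (s≤s t+1<k) (s≤s z≤n)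
              (trans (iter-root-skip s (avoids s (<-trans (n<1+n s) t+1<k))) (cong (skip e') eq))

  short⁺ : ∀ m → ShortCyclesAtRoot m σ → ShortCyclesAtRoot m π
  short⁺ m short x (suc t) t<m (s≤s z≤n) eq with anyUpTo? (λ s → iter π s x ≟ᶠ fz) (suc t)
  ... | yes found = found
  ... | no notFound = ⊥-elim (cases (skip-view e' x))
    where
      avoids : ∀ s → s < suc t → iter π s x ≢ fz
      avoids s s<t e = notFound (s , s<t , e)
      cases : x ≡ fs e' ⊎ ∃[ i ] x ≡ skip e' i → ⊥
      -- the new point would return to itself without meeting the root
      cases (inj₁ refl) = skip≢new e' _ (trans (sym (begin
        iter π (suc t) (fs e')               ≡⟨ iter-new t ⟩
        iter π t (skip e' (lookup σ fz))     ≡⟨ iter-skipπ t _ (λ s s<t e → avoids (suc s) (s≤s s<t) (trans (iter-new s) e)) ⟩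
        skip e' (iter σ t (lookup σ fz))     ∎)) eq)
      -- an old point on a short cycle would give one for σ, which meets the root
      cases (inj₂ (i , refl))
        with s , s<t , σˢi≡0 ← short i (suc t) t<m (s≤s z≤n)
                                 (skip-injective e' (trans (sym (iter-skipπ (suc t) i avoids)) eq))
        = avoids s s<t (trans (iter-skipπ s i (λ s' s'<s → avoids s' (<-trans s'<s s<t))) (cong (skip e') σˢi≡0))

  short⁻ : ∀ m → ShortCyclesAtRoot m π → ShortCyclesAtRoot m σ
  short⁻ m short y t t<m 1≤t eq with anyUpTo? (λ s → iter σ s y ≟ᶠ fz) t
  ... | yes found = found
  ... | no notFound = ⊥-elim (meets (short (skip e' y) t t<m 1≤t returns))
    where
      avoids : ∀ s → s < t → iter σ s y ≢ fz
      avoids s s<t e = notFound (s , s<t , e)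
      returns : iter π t (skip e' y) ≡ skip e' y
      returns = trans (iter-skipσ t y avoids) (cong (skip e') eq)
      meets : ∃[ s ] s < t × iter π s (skip e' y) ≡ fz → ⊥
      meets (s , s<t , πˢy≡0) = avoids s s<t (skip-root e' _
        (trans (sym (iter-skipσ s y (λ s' s'<s → avoids s' (<-trans s'<s s<t)))) πˢy≡0))

  rooted⁺ : ∀ m k → Rooted m k σ → Rooted m (suc k) π
  rooted⁺ m k (long , short) = rootCycle⁺ k long , short⁺ m short

  rooted⁻ : ∀ m k → Rooted m (suc k) π → Rooted m k σ
  rooted⁻ m k (long , short) = rootCycle⁻ k long , short⁻ m short

  π-on-old : ∀ i → (i ≡ fz × lookup π (skip e' i) ≡ fs e') ⊎ (i ≢ fz × lookup π (skip e' i) ≡ skip e' (lookup σ i))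
  π-on-old i with i ≟ᶠ fz
  ... | yes refl = inj₁ (refl , root↦new)
  ... | no  i≢0  = inj₂ (i≢0 , old↦old i i≢0)

  private
    new≠old : IsPerm σ → ∀ j → lookup π (fs e') ≢ lookup π (skip e' j)
    new≠old σ-inj j eq with π-on-old j
    ... | inj₁ (_ , πj≡e)    = skip≢new e' _ (trans (sym new↦next) (trans eq πj≡e))
    ... | inj₂ (j≢0 , πj≡σj) = j≢0 (sym (σ-inj fz j (skip-injective e' (trans (sym new↦next) (trans eq πj≡σj)))))

  perm⁺ : IsPerm σ → IsPerm π
  perm⁺ σ-inj x y eq with skip-view e' x | skip-view e' y
  ... | inj₁ refl       | inj₁ refl       = refl
  ... | inj₁ refl       | inj₂ (j , refl) = ⊥-elim (new≠old σ-inj j eq)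
  ... | inj₂ (i , refl) | inj₁ refl       = ⊥-elim (new≠old σ-inj i (sym eq))
  ... | inj₂ (i , refl) | inj₂ (j , refl) with π-on-old i | π-on-old j
  ... | inj₁ (i≡0 , _)  | inj₁ (j≡0 , _)  = cong (skip e') (trans i≡0 (sym j≡0))
  ... | inj₁ (_ , πi)   | inj₂ (_ , πj)   = ⊥-elim (skip≢new e' _ (sym (trans (sym πi) (trans eq πj))))
  ... | inj₂ (_ , πi)   | inj₁ (_ , πj)   = ⊥-elim (skip≢new e' _ (trans (sym πi) (trans eq πj)))
  ... | inj₂ (_ , πi)   | inj₂ (_ , πj)   =
    cong (skip e') (σ-inj i j (skip-injective e' (trans (sym πi) (trans eq πj))))

  perm⁻ : IsPerm π → IsPerm σ
  perm⁻ π-inj i j eq with i ≟ᶠ fz | j ≟ᶠ fz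
  ... | yes refl | yes refl = refl
  ... | yes refl | no j≢0  =
    ⊥-elim (skip≢new e' j (sym (π-inj _ _ (trans new↦next (trans (cong (skip e') eq) (sym (old↦old j j≢0)))))))
  ... | no i≢0  | yes refl =
    ⊥-elim (skip≢new e' i (π-inj _ _ (trans (old↦old i i≢0) (trans (cong (skip e') eq) (sym new↦next)))))
  ... | no i≢0  | no j≢0  =
    skip-injective e' (π-inj _ _ (trans (old↦old i i≢0) (trans (cong (skip e') eq) (sym (old↦old j j≢0)))))

insertion-unique : ∀ {n} {e' : Fin (suc n)} {σ π₁ π₂} → Insertion e' σ π₁ → Insertion e' σ π₂ → π₁ ≡ π₂
insertion-unique {e' = e'} {σ} {π₁} {π₂} ins₁ ins₂ = lookup-ext π₁ π₂ entries
  where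
    module I₁ = Insertion ins₁
    module I₂ = Insertion ins₂
    entries : ∀ x → lookup π₁ x ≡ lookup π₂ x
    entries x with skip-view e' x
    ... | inj₁ refl = trans I₁.new↦next (sym I₂.new↦next)
    ... | inj₂ (i , refl) with i ≟ᶠ fz
    ... | yes refl = trans I₁.root↦new (sym I₂.root↦new)
    ... | no  i≢0  = trans (I₁.old↦old i i≢0) (sym (I₂.old↦old i i≢0))

insertion-injective : ∀ {n} {e₁ e₂ : Fin (suc n)} {σ₁ σ₂ π} →
  Insertion e₁ σ₁ π → Insertion e₂ σ₂ π → e₁ ≡ e₂ × σ₁ ≡ σ₂
insertion-injective {e₁ = e₁} {σ₁ = σ₁} {σ₂} ins₁ ins₂
  with refl ← suc-injective (trans (sym (Insertion.root↦new ins₁)) (Insertion.root↦new ins₂))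
  = refl , lookup-ext σ₁ σ₂ entries
  where
    module I₁ = Insertion ins₁
    module I₂ = Insertion ins₂
    entries : ∀ i → lookup σ₁ i ≡ lookup σ₂ i
    entries i with i ≟ᶠ fz
    ... | yes refl = skip-injective e₁ (trans (sym I₁.new↦next) I₂.new↦next)
    ... | no  i≢0  = skip-injective e₁ (trans (sym (I₁.old↦old i i≢0)) (I₂.old↦old i i≢0))

insertEntry : ∀ {n} → Fin (suc n) → Vec (Fin (suc n)) (suc n) → Fin (suc (suc n)) → Fin (suc (suc n))
insertEntry e' σ y with y ≟ᶠ fz
... | yes _ = fs e'
... | no _ with fs e' ≟ᶠ y
...   | yes _  = skip e' (lookup σ fz)
...   | no e≢y = skip e' (lookup σ (punchOut e≢y))

insert : ∀ {n} → Fin (suc n) → Vec (Fin (suc n)) (suc n) → Vec (Fin (suc (suc n))) (suc (suc n))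
insert e' σ = tabulate (insertEntry e' σ)

insert-insertion : ∀ {n} (e' : Fin (suc n)) σ → Insertion e' σ (insert e' σ)
insert-insertion e' σ = record
  { root↦new = lookup∘tabulate (insertEntry e' σ) fz
  ; new↦next = trans (lookup∘tabulate (insertEntry e' σ) (fs e')) new-entry
  ; old↦old  = λ i i≢0 → trans (lookup∘tabulate (insertEntry e' σ) (skip e' i)) (old-entry i i≢0)
  }
  where
    new-entry : insertEntry e' σ (fs e') ≡ skip e' (lookup σ fz)
    new-entry with fs e' ≟ᶠ fs e'
    ... | yes _   = refl
    ... | no e≢e  = ⊥-elim (e≢e refl)
    old-entry : ∀ i → i ≢ fz → insertEntry e' σ (skip e' i) ≡ skip e' (lookup σ i)
    old-entry i i≢0 with skip e' i ≟ᶠ fz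
    ... | yes i↦0 = ⊥-elim (i≢0 (skip-root e' i i↦0))
    ... | no _ with fs e' ≟ᶠ skip e' i
    ...   | yes e≡i = ⊥-elim (skip≢new e' i (sym e≡i))
    ...   | no e≢i  = cong (λ j → skip e' (lookup σ j))
              (trans (punchOut-cong (fs e') {i≢k = punchInᵢ≢i (fs e') i ∘ sym} refl) (punchOut-punchIn (fs e')))

module _ {n} (π : Vec (Fin (suc (suc n))) (suc (suc n))) (π-inj : IsPerm π)
         (e' : Fin (suc n)) (π0≡e : lookup π fz ≡ fs e') where

  private
    e≢π[e] : fs e' ≢ lookup π (fs e')
    e≢π[e] e≡πe with () ← π-inj fz (fs e') (trans π0≡e e≡πe)

    e≢π[old] : ∀ i → fs e' ≢ lookup π (skip e' (fs i))
    e≢π[old] i e≡πi with () ← π-inj fz (skip e' (fs i)) (trans π0≡e e≡πi)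

    entry : Fin (suc n) → Fin (suc n)
    entry fz     = punchOut e≢π[e]
    entry (fs i) = punchOut (e≢π[old] i)

  delete : Vec (Fin (suc n)) (suc n)
  delete = tabulate entry

  delete-insertion : Insertion e' delete π
  delete-insertion = record
    { root↦new = π0≡e
    ; new↦next = sym (trans (cong (skip e') (lookup∘tabulate entry fz)) (punchIn-punchOut e≢π[e]))
    ; old↦old  = old
    }
    where
      old : ∀ i → i ≢ fz → lookup π (skip e' i) ≡ skip e' (lookup delete i)
      old fz     i≢0 = ⊥-elim (i≢0 refl)
      old (fs i) _   = sym (trans (cong (skip e') (lookup∘tabulate entry (fs i))) (punchIn-punchOut (e≢π[old] i)))

-- Counting rooted permutations

RootedPerms : ℕ → (n : ℕ) → ℕ → List (Vec (Fin (suc n)) (suc n))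
RootedPerms m n k = filter (rooted? m k) (Sym (suc n))

rootedCount : ℕ → ℕ → ℕ → ℕ
rootedCount m n k = length (RootedPerms m n k)

RootedPerms-unique : ∀ m n k → Unique (RootedPerms m n k)
RootedPerms-unique m n k = filter⁺ (rooted? m k) (Sym-unique (suc n))

∈-RootedPerms⁺ : ∀ {m n k π} → IsPerm π → Rooted m k π → π ∈ RootedPerms m n k
∈-RootedPerms⁺ {m} {k = k} π-inj = ∈-filter⁺ (rooted? m k) (∈-Sym⁺ π-inj)

∈-RootedPerms⁻ : ∀ {m n k π} → π ∈ RootedPerms m n k → IsPerm π × Rooted m k π
∈-RootedPerms⁻ {m} {n} {k} π∈ with π∈Sym , rooted ← ∈-filter⁻ (rooted? m k) {xs = Sym (suc n)} π∈ =
  ∈-Sym⁻ π∈Sym , rooted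

fixesRoot? : ∀ {n} (π : Vec (Fin (suc n)) (suc n)) → Dec (lookup π fz ≡ fz)
fixesRoot? π = lookup π fz ≟ᶠ fz

RootFixed RootMoved : ∀ m n k → List (Vec (Fin (suc n)) (suc n))
RootFixed m n k = filter fixesRoot? (RootedPerms m n k)
RootMoved m n k = filter (λ π → ¬? (fixesRoot? π)) (RootedPerms m n k)

rootedCount-split : ∀ m n k → rootedCount m n k ≡ length (RootFixed m n k) + length (RootMoved m n k)
rootedCount-split m n k = length-filter-split fixesRoot? (RootedPerms m n k)

-- Root-fixing permutations whose root cycle need not be long are the
-- extensions 'fixRoot σ' of permutations σ of Fin n without short cycles.
RootFixed-count : ∀ m n k → k ≤ 1 → length (RootFixed m n k) ≡ countNoShort m n
RootFixed-count m n k k≤1 =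
  trans (length-unique-≈ (filter⁺ fixesRoot? (RootedPerms-unique m n k)) fixRoot-unique (mk⇔ to from))
        (length-map fixRoot NoShortPerms)
  where
    NoShortPerms = filter (noShortCycle? m) (Sym n)
    fixRoot-unique : Unique (map fixRoot NoShortPerms)
    fixRoot-unique = map⁺ fixRoot-injective (filter⁺ (noShortCycle? m) (Sym-unique n))
    to : ∀ {π} → π ∈ RootFixed m n k → π ∈ map fixRoot NoShortPerms
    to {π} π∈ with π∈' , π0≡0 ← ∈-filter⁻ fixesRoot? {xs = RootedPerms m n k} π∈
              with π-inj , (_ , short) ← ∈-RootedPerms⁻ {m} {n} {k} π∈'
      = subst (_∈ map fixRoot NoShortPerms) fixRootσ≡π
          (∈-map⁺ fixRoot (∈-filter⁺ (noShortCycle? m) (∈-Sym⁺ σ-inj) σ-noShort))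
      where
        σ = unfixRoot π π-inj π0≡0
        fixRootσ≡π = fixRoot-unfixRoot π π-inj π0≡0
        σ-inj : IsPerm σ
        σ-inj = fixRoot-perm⁻ σ (subst IsPerm (sym fixRootσ≡π) π-inj)
        σ-noShort : NoShortCycle m σ
        σ-noShort = ℕ⇒noShortCycle m σ (fixRoot-short⁻ m σ (subst (ShortCyclesAtRoot m) (sym fixRootσ≡π) short))
    from : ∀ {π} → π ∈ map fixRoot NoShortPerms → π ∈ RootFixed m n k
    from π∈ with σ , σ∈ , refl ← ∈-map⁻ fixRoot π∈
            with σ∈Sym , ns ← ∈-filter⁻ (noShortCycle? m) {xs = Sym n} σ∈
      = ∈-filter⁺ fixesRoot? (∈-RootedPerms⁺ (fixRoot-perm⁺ σ (∈-Sym⁻ σ∈Sym))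
          (short-root , fixRoot-short⁺ m σ (noShortCycle⇒ℕ m σ ns))) refl
      where
        short-root : RootCycle≥ k (fixRoot σ)
        short-root t t<k 1≤t = ⊥-elim (<⇒≱ (<-≤-trans t<k k≤1) 1≤t)

-- A fixed root is a cycle of length 1, excluded once the root cycle must be longer.
RootFixed-none : ∀ m n k → length (RootFixed m n (suc (suc k))) ≡ 0
RootFixed-none m n k = cong length (filter-none fixesRoot? (All.tabulate λ π∈ →
  proj₁ (proj₂ (∈-RootedPerms⁻ {m} {n} π∈)) 1 (s≤s (s≤s z≤n)) (s≤s z≤n)))

RootMoved-none : ∀ m k → length (RootMoved m 0 k) ≡ 0
RootMoved-none m k = cong length (filter-none (λ π → ¬? (fixesRoot? π))
  (All.universal (λ π moves → moves (only-point (lookup π fz))) (RootedPerms m 0 k)))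
  where
    only-point : (x : Fin 1) → x ≡ fz
    only-point fz = refl

-- Rooted permutations of Fin (2 + n) moving the root are exactly the
-- insertions of one of the n + 1 new points into a rooted permutation of
-- Fin (1 + n) whose root cycle is one shorter.
RootMoved-count : ∀ m n k → length (RootMoved m (suc n) (suc k)) ≡ suc n * rootedCount m n k
RootMoved-count m n k =
  trans (length-unique-≈ (filter⁺ (λ π → ¬? (fixesRoot? π)) (RootedPerms-unique m (suc n) (suc k)))
                         insertions-unique (mk⇔ to from))
  (trans (length-cartesianProductWith insert (allFin (suc n)) (RootedPerms m n k))
         (cong (_* rootedCount m n k) (length-tabulate {n = suc n} (λ i → i))))
  where
    Insertions = cartesianProductWith insert (allFin (suc n)) (RootedPerms m n k)
    insert-injective : ∀ {e₁ e₂ σ₁ σ₂} → insert e₁ σ₁ ≡ insert e₂ σ₂ → e₁ ≡ e₂ × σ₁ ≡ σ₂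
    insert-injective {e₁} {e₂} {σ₁} {σ₂} eq = insertion-injective (insert-insertion e₁ σ₁)
      (subst (Insertion e₂ σ₂) (sym eq) (insert-insertion e₂ σ₂))
    insertions-unique : Unique Insertions
    insertions-unique = cartesianProductWith⁺ insert insert-injective (allFin⁺ (suc n)) (RootedPerms-unique m n k)
    to : ∀ {π} → π ∈ RootMoved m (suc n) (suc k) → π ∈ Insertions
    to {π} π∈ with π∈' , moves ← ∈-filter⁻ (λ π → ¬? (fixesRoot? π)) {xs = RootedPerms m (suc n) (suc k)} π∈
              with π-inj , rooted ← ∈-RootedPerms⁻ {m} {suc n} {suc k} π∈'
              with lookup π fz in π0
    ... | fz    = ⊥-elim (moves refl)
    ... | fs e' = subst (_∈ Insertions) (insertion-unique (insert-insertion e' σ) ins)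
                    (∈-cartesianProductWith⁺ insert (∈-allFin e')
                      (∈-RootedPerms⁺ (perm⁻ π-inj) (rooted⁻ m k rooted)))
      where
        σ = delete π π-inj e' π0
        ins = delete-insertion π π-inj e' π0
        open InsertionProperties ins
    from : ∀ {π} → π ∈ Insertions → π ∈ RootMoved m (suc n) (suc k)
    from π∈ with e' , σ , _ , σ∈ , refl ← ∈-cartesianProductWith⁻ insert (allFin (suc n)) (RootedPerms m n k) π∈
            with σ-inj , rooted ← ∈-RootedPerms⁻ {m} {n} {k} σ∈
      = ∈-filter⁺ (λ π → ¬? (fixesRoot? π)) (∈-RootedPerms⁺ (perm⁺ σ-inj) (rooted⁺ m k rooted))
          (λ π0≡0 → 0≢1+n (sym (trans (sym root↦new) π0≡0)))
      where
        open InsertionProperties (insert-insertion e' σ)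
        open Insertion (insert-insertion e' σ)
        0≢1+n : ∀ {i : Fin (suc n)} → fz ≢ fs i
        0≢1+n ()

-- With a(n) = countNoShort m n and B(n, k) = rootedCount m n k, the counts
-- above amount to the following recurrences.
record Recurrences (m : ℕ) (a : ℕ → ℕ) (B : ℕ → ℕ → ℕ) : Set where
  field
    a-zero      : a 0 ≡ 1
    a-suc       : ∀ n → a (suc n) ≡ B n m
    B-zero-one  : B 0 1 ≡ 1
    B-suc-one   : ∀ n → B (suc n) 1 ≡ a (suc n) + suc n * B n 1
    B-zero-long : ∀ k → B 0 (suc (suc k)) ≡ 0
    B-suc-long  : ∀ n k → B (suc n) (suc (suc k)) ≡ suc n * B n (suc k)

rootedCount-recurrences : ∀ m → Recurrences m (countNoShort m) (rootedCount m)
rootedCount-recurrences m = record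
  { a-zero      = refl
  ; a-suc       = noShort≡rooted
  ; B-zero-one  = trans (rootedCount-split m 0 1)
                    (cong₂ _+_ (RootFixed-count m 0 1 ≤-refl) (RootMoved-none m 1))
  ; B-suc-one   = λ n → trans (rootedCount-split m (suc n) 1)
                    (cong₂ _+_ (RootFixed-count m (suc n) 1 ≤-refl)
                               (trans (RootMoved-count m n 0) (cong (suc n *_) (rooted-0≡1 n))))
  ; B-zero-long = λ k → trans (rootedCount-split m 0 (suc (suc k)))
                    (cong₂ _+_ (RootFixed-none m 0 k) (RootMoved-none m (suc (suc k))))
  ; B-suc-long  = λ n k → trans (rootedCount-split m (suc n) (suc (suc k)))
                    (cong₂ _+_ (RootFixed-none m (suc n) k) (RootMoved-count m n (suc k)))
  }
  where
    noShort≡rooted : ∀ n → countNoShort m (suc n) ≡ rootedCount m n m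
    noShort≡rooted n = cong length (filter-≐ (noShortCycle? m) (rooted? m m)
      ((λ {π} ns → noShortCycle⇒rooted m π (noShortCycle⇒ℕ m π ns)) ,
       (λ {π} r → ℕ⇒noShortCycle m π (rooted⇒noShortCycle m π r)))
      (Sym (suc n)))
    -- root cycles of length ≥ 0 and ≥ 1 are both unconstrained
    rooted-0≡1 : ∀ n → rootedCount m n 0 ≡ rootedCount m n 1
    rooted-0≡1 n = cong length (filter-≐ (rooted? m 0) (rooted? m 1)
      ((λ (_ , short) → (λ { t (s≤s z≤n) () }) , short) , (λ (_ , short) → (λ _ ()) , short))
      (Sym (suc n)))

-- Solving the recurrences

private
  rearrange : ∀ x y z → x * y * z ≡ y * (x * z)
  rearrange = solve-∀
  swap : ∀ x y z → x * (y * z) ≡ y * (x * z)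
  swap = solve-∀
  expand-suc : ∀ n m f → (suc n + m) * (suc n * f) ≡ suc n * f + suc n * ((n + m) * f)
  expand-suc = solve-∀

recurrences-factorial : ∀ {a B} → Recurrences 1 a B → ∀ n → a n ≡ n !
recurrences-factorial rec zero        = Recurrences.a-zero rec
recurrences-factorial {B = B} rec (suc n) = trans (a-suc n) (B-one n)
  where
    open Recurrences rec
    B-one : ∀ n → B n 1 ≡ suc n !
    B-one zero    = B-zero-one
    B-one (suc n) = trans (B-suc-one n) (trans (cong (_+ suc n * B n 1) (a-suc n))
                                               (cong (λ x → x + suc n * x) (B-one n)))

-- Writing C(j) = B(j, 1), the ratio c(j) = C(j)/j! satisfies c(j+1) = c(j) + a(j+1)/(j+1)!
-- and a(n+1)/(n+1)! = c(n-k)/(n+1); by strong induction c(j) ∈ [(j+m)/2m, (j+m)/m].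
module RecurrenceBounds {k : ℕ} {a : ℕ → ℕ} {B : ℕ → ℕ → ℕ} (rec : Recurrences (suc k) a B) where

  open Recurrences rec

  m : ℕ
  m = suc k

  C : ℕ → ℕ
  C n = B n 1

  -- A root cycle cannot be longer than the whole set.
  B-vanish : ∀ j n → n < j → B n (suc j) ≡ 0
  B-vanish (suc j) zero    _         = B-zero-long j
  B-vanish (suc j) (suc n) (s≤s n<j) =
    trans (B-suc-long n j) (trans (cong (suc n *_) (B-vanish j n n<j)) (*-zeroʳ (suc n)))

  -- Unfolding B-suc-long j times: B(n, j+1) = n!/(n-j)! · C(n-j).
  B-closed : ∀ j n → j ≤ n → B n (suc j) * (n ∸ j) ! ≡ n ! * C (n ∸ j)
  B-closed zero    n       _         = *-comm (B n 1) (n !)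
  B-closed (suc j) (suc n) (s≤s j≤n) = begin
    B (suc n) (suc (suc j)) * (n ∸ j) !   ≡⟨ cong (_* (n ∸ j) !) (B-suc-long n j) ⟩
    suc n * B n (suc j) * (n ∸ j) !       ≡⟨ *-assoc (suc n) (B n (suc j)) ((n ∸ j) !) ⟩
    suc n * (B n (suc j) * (n ∸ j) !)     ≡⟨ cong (suc n *_) (B-closed j n j≤n) ⟩
    suc n * (n ! * C (n ∸ j))             ≡⟨ sym (*-assoc (suc n) (n !) (C (n ∸ j))) ⟩
    suc n ! * C (n ∸ j)                   ∎
    where open ≡-Reasoning

  a-closed : ∀ n → k ≤ n → a (suc n) * (n ∸ k) ! ≡ n ! * C (n ∸ k)
  a-closed n k≤n = trans (cong (_* (n ∸ k) !) (a-suc n)) (B-closed k n k≤n)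

  -- On fewer than m points every cycle is short, so all cycles lie at the root
  -- only when the root carries the single cycle, whence C(j) = j! there.
  C-small : ∀ j → j < m → C j ≡ j !
  C-small zero    _         = B-zero-one
  C-small (suc j) (s≤s j<k) = begin
    C (suc j)                   ≡⟨ B-suc-one j ⟩
    a (suc j) + suc j * C j     ≡⟨ cong₂ _+_ (trans (a-suc j) (B-vanish k j j<k)) (cong (suc j *_) (C-small j (m<n⇒m<1+n j<k))) ⟩
    suc j !                     ∎
    where open ≡-Reasoning

  -- The invariant (j + m)/(2m) ≤ C(j)/j! ≤ (j + m)/m, cleared of denominators.
  Bracket : ℕ → Set
  Bracket j = ((j + m) * j ! ≤ 2 * m * C j) × (m * C j ≤ (j + m) * j !)

  Bracket-small : ∀ j → j < m → Bracket j
  Bracket-small j j<m rewrite C-small j j<m = *-monoˡ-≤ (j !) j+m≤2m , *-monoˡ-≤ (j !) (m≤n+m m j)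
    where
      j+m≤2m : j + m ≤ 2 * m
      j+m≤2m = subst (j + m ≤_) (cong (m +_) (sym (+-identityʳ m))) (+-monoˡ-≤ m (<⇒≤ j<m))

  a-bounds : ∀ n → k ≤ n → Bracket (n ∸ k) → (suc n ! ≤ 2 * m * a (suc n)) × (m * a (suc n) ≤ suc n !)
  a-bounds n k≤n (lower , upper) =
    *-cancelʳ-≤ _ _ (r !) {{r !≢0}} lower′ , *-cancelʳ-≤ _ _ (r !) {{r !≢0}} upper′
    where
      r = n ∸ k
      r+m≡1+n : r + m ≡ suc n
      r+m≡1+n = trans (+-suc r k) (cong suc (m∸n+n≡m k≤n))
      open ≤-Reasoning
      lower′ : suc n ! * r ! ≤ 2 * m * a (suc n) * r !
      lower′ = begin
        suc n ! * r !                ≡⟨ rearrange (suc n) (n !) (r !) ⟩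
        n ! * (suc n * r !)          ≡⟨ cong (λ x → n ! * (x * r !)) (sym r+m≡1+n) ⟩
        n ! * ((r + m) * r !)        ≤⟨ *-monoʳ-≤ (n !) lower ⟩
        n ! * (2 * m * C r)          ≡⟨ swap (n !) (2 * m) (C r) ⟩
        2 * m * (n ! * C r)          ≡⟨ cong (2 * m *_) (a-closed n k≤n) ⟨
        2 * m * (a (suc n) * r !)    ≡⟨ *-assoc (2 * m) (a (suc n)) (r !) ⟨
        2 * m * a (suc n) * r !      ∎
      upper′ : m * a (suc n) * r ! ≤ suc n ! * r !
      upper′ = begin
        m * a (suc n) * r !          ≡⟨ *-assoc m (a (suc n)) (r !) ⟩
        m * (a (suc n) * r !)        ≡⟨ cong (m *_) (a-closed n k≤n) ⟩
        m * (n ! * C r)              ≡⟨ swap m (n !) (C r) ⟩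
        n ! * (m * C r)              ≤⟨ *-monoʳ-≤ (n !) upper ⟩
        n ! * ((r + m) * r !)        ≡⟨ cong (λ x → n ! * (x * r !)) r+m≡1+n ⟩
        n ! * (suc n * r !)          ≡⟨ rearrange (suc n) (n !) (r !) ⟨
        suc n ! * r !                ∎

  Bracket-suc : ∀ n → (suc n ! ≤ 2 * m * a (suc n)) × (m * a (suc n) ≤ suc n !) → Bracket n → Bracket (suc n)
  Bracket-suc n (a-lower , a-upper) (lower , upper) = lower′ , upper′
    where
      open ≤-Reasoning
      expand : (suc n + m) * suc n ! ≡ suc n ! + suc n * ((n + m) * n !)
      expand = expand-suc n m (n !)
      lower′ : (suc n + m) * suc n ! ≤ 2 * m * C (suc n)
      lower′ = begin
        (suc n + m) * suc n !                       ≡⟨ expand ⟩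
        suc n ! + suc n * ((n + m) * n !)           ≤⟨ +-mono-≤ a-lower (*-monoʳ-≤ (suc n) lower) ⟩
        2 * m * a (suc n) + suc n * (2 * m * C n)   ≡⟨ cong (2 * m * a (suc n) +_) (swap (suc n) (2 * m) (C n)) ⟩
        2 * m * a (suc n) + 2 * m * (suc n * C n)   ≡⟨ *-distribˡ-+ (2 * m) (a (suc n)) (suc n * C n) ⟨
        2 * m * (a (suc n) + suc n * C n)           ≡⟨ cong (2 * m *_) (B-suc-one n) ⟨
        2 * m * C (suc n)                           ∎
      upper′ : m * C (suc n) ≤ (suc n + m) * suc n !
      upper′ = begin
        m * C (suc n)                       ≡⟨ cong (m *_) (B-suc-one n) ⟩
        m * (a (suc n) + suc n * C n)       ≡⟨ *-distribˡ-+ m (a (suc n)) (suc n * C n) ⟩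
        m * a (suc n) + m * (suc n * C n)   ≡⟨ cong (m * a (suc n) +_) (swap m (suc n) (C n)) ⟩
        m * a (suc n) + suc n * (m * C n)   ≤⟨ +-mono-≤ a-upper (*-monoʳ-≤ (suc n) upper) ⟩
        suc n ! + suc n * ((n + m) * n !)   ≡⟨ expand ⟨
        (suc n + m) * suc n !               ∎

  Bracket-all : ∀ j → Bracket j
  Bracket-all = <-rec Bracket step
    where
      step : ∀ j → (∀ {i} → i < j → Bracket i) → Bracket j
      step j ih with j <? m
      ... | yes j<m = Bracket-small j j<m
      step zero    ih | no j≮m = Bracket-small zero (s≤s z≤n)
      step (suc n) ih | no j≮m = Bracket-suc n (a-bounds n k≤n (ih (s≤s (m∸n≤m n k)))) (ih ≤-refl)
        where
          k≤n : k ≤ n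
          k≤n = ≤-pred (≮⇒≥ j≮m)

  bounds : ∀ n → m ≤ n → (n ! ≤ 2 * m * a n) × (m * a n ≤ n !)
  bounds (suc n) (s≤s k≤n) = a-bounds n k≤n (Bracket-all (n ∸ k))

-- |S_n| = n!: every permutation has no cycle of length < 1.
length-Sym : ∀ n → length (Sym n) ≡ n !
length-Sym n = begin
  length (Sym n)       ≡⟨ cong length (filter-all (noShortCycle? 1) (All.universal noCycle<1 (Sym n))) ⟨
  countNoShort 1 n     ≡⟨ recurrences-factorial (rootedCount-recurrences 1) n ⟩
  n !                  ∎
  where
    open ≡-Reasoning
    noCycle<1 : ∀ π → NoShortCycle 1 π
    noCycle<1 π i fz ()

lemma2p3 : (m n : ℕ) → 1 ≤ m → m ≤ n →
    (length (Sym n) ≤ 2 * m * countNoShort m n) × (m * countNoShort m n ≤ length (Sym n))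
lemma2p3 (suc k) n (s≤s z≤n) m≤n rewrite length-Sym n =
  RecurrenceBounds.bounds (rootedCount-recurrences (suc k)) n m≤n
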